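{- For every $*$-term $P$, the tree $se(P)$ can be written as $X[\triangle\mapsto Y]$ with $X\in\mathcal T_{A,\triangle}$ and $Y\in\mathcal T_A$ such that $X$ contains $\triangle$ and $Y=se(R)$, where $R$ is the rightmost $\ell$-term occurring in $P$ ($X$ may be the tree $\triangle$ itself).
   Context: Closed terms over constants $\mathsf T,\mathsf F$, atoms $a\in A$ ($A$ non-empty), unary $\neg$ and binary $\wedge,\vee$. Grammar (with $a\in A$): $P^{\mathsf T}::=\mathsf T\mid (a\wedge P^{\mathsf T})\vee P^{\mathsf T}$; $P^{\mathsf F}::=\mathsf F\mid (a\vee P^{\mathsf F})\wedge P^{\mathsf F}$; $\ell$-terms $P^\ell::=(a\wedge P^{\mathsf T})\vee P^{\mathsf F}\mid(\neg a\wedge P^{\mathsf T})\vee P^{\mathsf F}$; $*$-terms $P^*::=P^c\mid P^d$, $P^c::=P^\ell\mid P^*\wedge P^d$, $P^d::=P^\ell\mid P^*\vee P^c$. A $*$-term is thus built from $\ell$-terms by $\wedge,\vee$; its rightmost $\ell$-term is the last of these $\ell$-term constituents. $\mathcal T_A$: least set containing $\mathsf T,\mathsf F$ and $X\trianglelefteq a\trianglerighteq Y$ for $X,Y\in\mathcal T_A$, $a\in A$; $\mathcal T_{A,\triangle}$ is defined likewise but with leaves in $\{\mathsf T,\mathsf F,\triangle\}$. Leaf replacement $X[\ell_1\mapsto Y_1,\dots]$ replaces every leaf $\ell_i$ of $X$ by $Y_i$ (other leaves unchanged). $se(\mathsf T)=\mathsf T$, $se(\mathsf F)=\mathsf F$,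 $se(a)=\mathsf T\trianglelefteq a\trianglerighteq\mathsf F$, $se(\neg P)=se(P)[\mathsf T\mapsto\mathsf F,\mathsf F\mapsto\mathsf T]$, $se(P\wedge Q)=se(P)[\mathsf T\mapsto se(Q)]$, $se(P\vee Q)=se(P)[\mathsf F\mapsto se(Q)]$. -}

module Defs where

open import Data.Empty using (⊥)
open import Data.Unit using (⊤)
open import Data.Product using (_×_)

data Term (A : Set) : Set where
  T F   : Term A
  at    : A → Term A
  ¬'_   : Term A → Term A
  _∧'_  : Term A → Term A → Term A
  _∨'_  : Term A → Term A → Term A

module _ {A : Set} where

  data IsPT : Term A → Set where
    pT  : IsPT T
    pT∨ : ∀ {a P Q} → IsPT P → IsPT Q → IsPT ((at a ∧' P) ∨' Q)

  data IsPF : Term A → Set where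
    pF  : IsPF F
    pF∧ : ∀ {a P Q} → IsPF P → IsPF Q → IsPF ((at a ∨' P) ∧' Q)

  -- ℓ-terms: (a ∧ P^T) ∨ P^F | (¬a ∧ P^T) ∨ P^F
  data IsLit : Term A → Set where
    lpos : ∀ {a P Q} → IsPT P → IsPF Q → IsLit ((at a ∧' P) ∨' Q)
    lneg : ∀ {a P Q} → IsPT P → IsPF Q → IsLit (((¬' at a) ∧' P) ∨' Q)

  -- *-terms, P^c and P^d, indexed by their rightmost ℓ-term R:
  -- IsStar P R  : P is a *-term whose rightmost ℓ-term is R.
  -- P^* ::= P^c | P^d ; P^c ::= P^ℓ | P^* ∧ P^d ; P^d ::= P^ℓ | P^* ∨ P^c
  mutual
    data IsStar : Term A → Term A → Set where
      sc : ∀ {P R} → IsC P R → IsStar P R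
      sd : ∀ {P R} → IsD P R → IsStar P R

    data IsC : Term A → Term A → Set where
      cl : ∀ {P} → IsLit P → IsC P P
      c∧ : ∀ {P Q R S} → IsStar P S → IsD Q R → IsC (P ∧' Q) R

    data IsD : Term A → Term A → Set where
      dl : ∀ {P} → IsLit P → IsD P P
      d∨ : ∀ {P Q R S} → IsStar P S → IsC Q R → IsD (P ∨' Q) R

data Leaf : Set where
  lT lF l△ : Leaf

data Tree (A : Set) : Set where
  leaf : Leaf → Tree A
  node : Tree A → A → Tree A → Tree A

module _ {A : Set} where

  data Has△ : Tree A → Set where
    here  : Has△ (leaf l△)
    left  : ∀ {X a Y} → Has△ X → Has△ (node X a Y)
    right : ∀ {X a Y} → Has△ Y → Has△ (node X a Y)

  NoTri : Tree A → Set
  NoTri (leaf lT) = ⊤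
  NoTri (leaf lF) = ⊤
  NoTri (leaf l△) = ⊥
  NoTri (node X _ Y) = NoTri X × NoTri Y

  repl : Tree A → Tree A → Tree A → Tree A → Tree A
  repl (leaf lT) t f d = t
  repl (leaf lF) t f d = f
  repl (leaf l△) t f d = d
  repl (node X a Y) t f d = node (repl X t f d) a (repl Y t f d)

  tT tF : Tree A
  tT = leaf lT
  tF = leaf lF

  _[△↦_] : Tree A → Tree A → Tree A
  X [△↦ Y ] = repl X tT tF Y

  se : Term A → Tree A
  se T = tT
  se F = tF
  se (at a) = node tT a tF
  se (¬' P) = repl (se P) tF tT (leaf l△)
  se (P ∧' Q) = repl (se P) (se Q) tF (leaf l△)
  se (P ∨' Q) = repl (se P) tT (se Q) (leaf l△)

-- Every *-term P is bivalent: se P has a T-leaf and an F-leaf. Hence in se (P ∧ Q) = se P [T ↦ se Q]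
-- the tree se Q really occurs below se P, and a context for the rightmost ℓ-term R inside se Q
-- extends to one inside se (P ∧ Q) by plugging it into the T-leaves of se P (dually for ∨).
-- Since se P has no △-leaves, its own △-branch is irrelevant for this plugging.
module Submission where

open import Defs
open import Data.Product using (Σ; _×_; _,_; proj₁; proj₂)
open import Data.Unit using (tt)
open import Relation.Binary.PropositionalEquality using (_≡_; refl; cong; cong₂; sym; module ≡-Reasoning)

module _ {A : Set} where

  △ : Tree A
  △ = leaf l△

  data HasLeaf (l : Leaf) : Tree A → Set where
    here  : HasLeaf l (leaf l)
    left  : ∀ {X a Y} → HasLeaf l X → HasLeaf l (node X a Y)
    right : ∀ {X a Y} → HasLeaf l Y → HasLeaf l (node X a Y)

  hasLeaf-△⇒Has△ : ∀ {X : Tree A} → HasLeaf l△ X → Has△ X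
  hasLeaf-△⇒Has△ here      = here
  hasLeaf-△⇒Has△ (left h)  = left (hasLeaf-△⇒Has△ h)
  hasLeaf-△⇒Has△ (right h) = right (hasLeaf-△⇒Has△ h)

  hasLeaf-repl : ∀ {k l} {Z t f d : Tree A} →
    HasLeaf k Z → HasLeaf l (repl (leaf k) t f d) → HasLeaf l (repl Z t f d)
  hasLeaf-repl here      h = h
  hasLeaf-repl (left z)  h = left (hasLeaf-repl z h)
  hasLeaf-repl (right z) h = right (hasLeaf-repl z h)

  noTri-repl : ∀ (Z : Tree A) {t f d} → NoTri Z → NoTri t → NoTri f → NoTri (repl Z t f d)
  noTri-repl (leaf lT)    _         nt _  = nt
  noTri-repl (leaf lF)    _         _  nf = nf
  noTri-repl (node X a Y) (nX , nY) nt nf = noTri-repl X nX nt nf , noTri-repl Y nY nt nf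

  repl-ignores-△ : ∀ (Z : Tree A) {t f d d′} → NoTri Z → repl Z t f d ≡ repl Z t f d′
  repl-ignores-△ (leaf lT)    _         = refl
  repl-ignores-△ (leaf lF)    _         = refl
  repl-ignores-△ (node X a Y) (nX , nY) =
    cong₂ (λ X′ Y′ → node X′ a Y′) (repl-ignores-△ X nX) (repl-ignores-△ Y nY)

  repl-repl : ∀ (Z : Tree A) {t f d t′ f′ d′} →
    repl (repl Z t f d) t′ f′ d′ ≡ repl Z (repl t t′ f′ d′) (repl f t′ f′ d′) (repl d t′ f′ d′)
  repl-repl (leaf lT)    = refl
  repl-repl (leaf lF)    = refl
  repl-repl (leaf l△)    = refl
  repl-repl (node X a Y) = cong₂ (λ X′ Y′ → node X′ a Y′) (repl-repl X) (repl-repl Y)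

  noTri-se : (P : Term A) → NoTri (se P)
  noTri-se T        = tt
  noTri-se F        = tt
  noTri-se (at a)   = tt , tt
  noTri-se (¬' P)   = noTri-repl (se P) (noTri-se P) tt tt
  noTri-se (P ∧' Q) = noTri-repl (se P) (noTri-se P) (noTri-se Q) tt
  noTri-se (P ∨' Q) = noTri-repl (se P) (noTri-se P) tt (noTri-se Q)

  record Reaches (l : Leaf) (P : Term A) : Set where
    constructor reach
    field leafOf : HasLeaf l (se P)

  open Reaches

  ∧-reachesʳ : ∀ {l} {P Q : Term A} → Reaches lT P → Reaches l Q → Reaches l (P ∧' Q)
  ∧-reachesʳ {P = P} {Q} (reach p) (reach q) = reach (hasLeaf-repl {Z = se P} {se Q} {tF} {△} p q)

  ∧-reachesF : ∀ {P Q : Term A} → Reaches lF P → Reaches lF (P ∧' Q)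
  ∧-reachesF {P} {Q} (reach p) = reach (hasLeaf-repl {Z = se P} {se Q} {tF} {△} p here)

  ∨-reachesʳ : ∀ {l} {P Q : Term A} → Reaches lF P → Reaches l Q → Reaches l (P ∨' Q)
  ∨-reachesʳ {P = P} {Q} (reach p) (reach q) = reach (hasLeaf-repl {Z = se P} {tT} {se Q} {△} p q)

  ∨-reachesT : ∀ {P Q : Term A} → Reaches lT P → Reaches lT (P ∨' Q)
  ∨-reachesT {P} {Q} (reach p) = reach (hasLeaf-repl {Z = se P} {tT} {se Q} {△} p here)

  Bivalent : Term A → Set
  Bivalent P = Reaches lT P × Reaches lF P

  bivalent-at : ∀ (a : A) → Bivalent (at a)
  bivalent-at a = reach (left here) , reach (right here)

  bivalent-¬at : ∀ (a : A) → Bivalent (¬' at a)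
  bivalent-¬at a = reach (right here) , reach (left here)

  bivalent-∧ : ∀ {P Q : Term A} → Bivalent P → Reaches lT Q → Bivalent (P ∧' Q)
  bivalent-∧ (pᵀ , pᶠ) qᵀ = ∧-reachesʳ pᵀ qᵀ , ∧-reachesF pᶠ

  bivalent-∨ : ∀ {P Q : Term A} → Bivalent P → Reaches lF Q → Bivalent (P ∨' Q)
  bivalent-∨ (pᵀ , pᶠ) qᶠ = ∨-reachesT pᵀ , ∨-reachesʳ pᶠ qᶠ

  isPT⇒reachesT : ∀ {P : Term A} → IsPT P → Reaches lT P
  isPT⇒reachesT pT            = reach here
  isPT⇒reachesT (pT∨ {a} p _) = ∨-reachesT (proj₁ (bivalent-∧ (bivalent-at a) (isPT⇒reachesT p)))

  isPF⇒reachesF : ∀ {P : Term A} → IsPF P → Reaches lF P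
  isPF⇒reachesF pF            = reach here
  isPF⇒reachesF (pF∧ {a} p _) = ∧-reachesF (proj₂ (bivalent-∨ (bivalent-at a) (isPF⇒reachesF p)))

  isLit⇒bivalent : ∀ {P : Term A} → IsLit P → Bivalent P
  isLit⇒bivalent (lpos {a} p q) =
    bivalent-∨ (bivalent-∧ (bivalent-at a) (isPT⇒reachesT p)) (isPF⇒reachesF q)
  isLit⇒bivalent (lneg {a} p q) =
    bivalent-∨ (bivalent-∧ (bivalent-¬at a) (isPT⇒reachesT p)) (isPF⇒reachesF q)

  mutual
    isStar⇒bivalent : ∀ {P R : Term A} → IsStar P R → Bivalent P
    isStar⇒bivalent (sc c) = isC⇒bivalent c
    isStar⇒bivalent (sd d) = isD⇒bivalent d

    isC⇒bivalent : ∀ {P R : Term A} → IsC P R → Bivalent P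
    isC⇒bivalent (cl l)   = isLit⇒bivalent l
    isC⇒bivalent (c∧ s d) = bivalent-∧ (isStar⇒bivalent s) (proj₁ (isD⇒bivalent d))

    isD⇒bivalent : ∀ {P R : Term A} → IsD P R → Bivalent P
    isD⇒bivalent (dl l)   = isLit⇒bivalent l
    isD⇒bivalent (d∨ s c) = bivalent-∨ (isStar⇒bivalent s) (proj₂ (isC⇒bivalent c))

  Plugged : Tree A → Tree A → Set
  Plugged Z Y = Σ (Tree A) λ X → HasLeaf l△ X × (Z ≡ X [△↦ Y ])

  plugged-refl : ∀ (Y : Tree A) → Plugged Y Y
  plugged-refl Y = △ , here , refl

  plugged-replT : ∀ (Z : Tree A) {t Y} → NoTri Z → HasLeaf lT Z → Plugged t Y → Plugged (repl Z t tF △) Y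
  plugged-replT Z {t} {Y} noTri z (X , hole , eq) =
    repl Z X tF △ , hasLeaf-repl {Z = Z} {X} {tF} {△} z hole , plug
    where
      open ≡-Reasoning
      plug : repl Z t tF △ ≡ repl Z X tF △ [△↦ Y ]
      plug = begin
        repl Z t tF △                ≡⟨ cong (λ u → repl Z u tF △) eq ⟩
        repl Z (X [△↦ Y ]) tF △      ≡⟨ repl-ignores-△ Z noTri ⟩
        repl Z (X [△↦ Y ]) tF Y      ≡⟨ sym (repl-repl Z) ⟩
        repl Z X tF △ [△↦ Y ]        ∎

  plugged-replF : ∀ (Z : Tree A) {f Y} → NoTri Z → HasLeaf lF Z → Plugged f Y → Plugged (repl Z tT f △) Y
  plugged-replF Z {f} {Y} noTri z (X , hole , eq) =
    repl Z tT X △ , hasLeaf-repl {Z = Z} {tT} {X} {△} z hole , plug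
    where
      open ≡-Reasoning
      plug : repl Z tT f △ ≡ repl Z tT X △ [△↦ Y ]
      plug = begin
        repl Z tT f △                ≡⟨ cong (λ u → repl Z tT u △) eq ⟩
        repl Z tT (X [△↦ Y ]) △      ≡⟨ repl-ignores-△ Z noTri ⟩
        repl Z tT (X [△↦ Y ]) Y      ≡⟨ sym (repl-repl Z) ⟩
        repl Z tT X △ [△↦ Y ]        ∎

  mutual
    isStar⇒plugged : ∀ {P R : Term A} → IsStar P R → Plugged (se P) (se R)
    isStar⇒plugged (sc c) = isC⇒plugged c
    isStar⇒plugged (sd d) = isD⇒plugged d

    isC⇒plugged : ∀ {P R : Term A} → IsC P R → Plugged (se P) (se R)
    isC⇒plugged {P} (cl _) = plugged-refl (se P)
    isC⇒plugged (c∧ {P} s d) =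
      plugged-replT (se P) (noTri-se P) (leafOf (proj₁ (isStar⇒bivalent s))) (isD⇒plugged d)

    isD⇒plugged : ∀ {P R : Term A} → IsD P R → Plugged (se P) (se R)
    isD⇒plugged {P} (dl _) = plugged-refl (se P)
    isD⇒plugged (d∨ {P} s c) =
      plugged-replF (se P) (noTri-se P) (leafOf (proj₂ (isStar⇒bivalent s))) (isC⇒plugged c)

lemma3p2 : {A : Set} → A → (P R : Term A) → IsStar P R →
    Σ (Tree A) λ X → Σ (Tree A) λ Y →
    Has△ X × NoTri Y × (Y ≡ se R) × (se P ≡ X [△↦ Y ])
lemma3p2 _ P R s with isStar⇒plugged s
... | X , hole , eq = X , se R , hasLeaf-△⇒Has△ hole , noTri-se R , refl , eq
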